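{- $g_{\mathbb{Z}_2[\sqrt[3]{2}]}(6) = 6$.
   Context: For a ring $R$ and an integer $k > 1$, let $R^k$ denote the additive semigroup generated by all $k$-th powers of elements of $R$. The Waring number $g_R(k)$ is the smallest positive integer such that every element of $R^k$ can be written as a sum of at most $g_R(k)$ $k$-th powers of elements of $R$. $\mathbb{Z}_2$ denotes the $2$-adic integers and $\mathbb{Z}_2[\sqrt[3]{2}]$ is the ring of integers of $\mathbb{Q}_2(\sqrt[3]{2})$. -}

module Defs where

-- The ring ℤ₂[∛2] (ring of integers of ℚ₂(∛2)) realised as the inverse limit
--   ℤ₂[∛2] = lim_n  ℤ₂[∛2] / 2ⁿ  ≅  lim_n (ℤ/2ⁿℤ)[t]/(t³ - 2),
-- using the ℤ₂-basis 1, π, π² with π = ∛2 (π³ = 2).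

open import Data.Nat using (ℕ; suc; _≤_)
import Data.Nat as ℕ
open import Data.Integer using (ℤ; +_; _+_; _*_; _-_)
open import Data.Integer.Divisibility using (_∣_)
open import Data.List using (List; []; _∷_; length)
open import Data.Product using (Σ; _×_; _,_; ∃)

_≡_[mod2^_] : ℤ → ℤ → ℕ → Set
a ≡ b [mod2^ n ] = (+ (2 ℕ.^ n)) ∣ (a - b)

record Tri : Set where
  constructor tri
  field
    c₀ c₁ c₂ : ℤ
open Tri public

_≈Tri_[mod2^_] : Tri → Tri → ℕ → Set
x ≈Tri y [mod2^ n ] =
  (c₀ x ≡ c₀ y [mod2^ n ]) × (c₁ x ≡ c₁ y [mod2^ n ]) × (c₂ x ≡ c₂ y [mod2^ n ])

_+T_ : Tri → Tri → Tri
tri a₀ a₁ a₂ +T tri b₀ b₁ b₂ = tri (a₀ + b₀) (a₁ + b₁) (a₂ + b₂)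

-- multiplication in ℤ[π] with π³ = 2
_*T_ : Tri → Tri → Tri
tri a₀ a₁ a₂ *T tri b₀ b₁ b₂ =
  tri (a₀ * b₀ + + 2 * (a₁ * b₂ + a₂ * b₁))
      (a₀ * b₁ + a₁ * b₀ + + 2 * (a₂ * b₂))
      (a₀ * b₂ + a₁ * b₁ + a₂ * b₀)

0T 1T : Tri
0T = tri (+ 0) (+ 0) (+ 0)
1T = tri (+ 1) (+ 0) (+ 0)

-- Raw (not yet compatibility-checked) elements of the inverse limit
R : Set
R = ℕ → Tri

Valid : R → Set
Valid x = ∀ n → x (suc n) ≈Tri x n [mod2^ n ]

_≈_ : R → R → Set
x ≈ y = ∀ n → x n ≈Tri y n [mod2^ n ]

_⊕_ : R → R → R
(x ⊕ y) n = x n +T y n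

_⊗_ : R → R → R
(x ⊗ y) n = x n *T y n

𝟘 𝟙 : R
𝟘 n = 0T
𝟙 n = 1T

_^R_ : R → ℕ → R
x ^R ℕ.zero = 𝟙
x ^R suc k = x ⊗ (x ^R k)

AllValid : List R → Set
AllValid [] = Data.Unit.⊤ where import Data.Unit
AllValid (x ∷ xs) = Valid x × AllValid xs

sumPow : ℕ → List R → R
sumPow k [] = 𝟘
sumPow k (x ∷ xs) = (x ^R k) ⊕ sumPow k xs

SumOfAtMost : ℕ → ℕ → R → Set
SumOfAtMost k m y =
  Σ (List R) λ xs → AllValid xs × (length xs ≤ m) × (sumPow k xs ≈ y)

InPowSemigroup : ℕ → R → Set
InPowSemigroup k y =
  Σ (List R) λ xs → AllValid xs × (1 ≤ length xs) × (sumPow k xs ≈ y)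

WaringBound : ℕ → ℕ → Set
WaringBound k m = (y : R) → Valid y → InPowSemigroup k y → SumOfAtMost k m y

WaringNumberIs : ℕ → ℕ → Set
WaringNumberIs k m =
  (1 ≤ m) × WaringBound k m × ((m′ : ℕ) → 1 ≤ m′ → m′ ℕ.< m → ¬ WaringBound k m′)
  where open import Relation.Nullary using (¬_)

{-# OPTIONS --safe #-}
-- Write π = ∛2, so that 2 = π³ and 6 = π³ · 3.  Squares, hence sixth powers and their sums,
-- have even π-coefficient.  Conversely, Hensel's lemma for sixth powers turns a unit b with
-- b⁶ ≡ y (mod π⁷) into an exact sixth root of y: an error π^(7+k) a with a odd is removed by
-- replacing b with b + π^(4+k), which changes b⁶ by π^(7+k) · 3b⁵ modulo π^(8+k).  A finite
-- table writes every class modulo π⁷ with even π-coefficient as b⁶ plus at most five constant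
-- sixth powers, so six sixth powers always suffice.  They are also necessary: modulo 4 a sixth
-- power is one of five residues, and no sum of five of them is congruent to
-- 138 + 108π + 81π² = 3 · 1⁶ + 3 · (1 + π)⁶.

module Submission where

open import Defs
open import Algebra.Bundles using (CommutativeRing)
open import Data.Integer as ℤ using (ℤ; +_; -_; _+_; _*_; _-_; ∣_∣)
import Data.Integer.Properties as ℤ
open import Data.Integer.DivMod using (_%ℕ_; _/ℕ_; n%ℕd<d; a≡a%ℕn+[a/ℕn]*n)
open import Data.Integer.Divisibility using (_∣_)
open import Data.Integer.Divisibility.Signed using (divides; ∣⇒∣ᵤ; ∣ᵤ⇒∣)
open import Data.Integer.Tactic.RingSolver using (solve-∀)
open import Data.List using (List; []; _∷_; length; map; cartesianProductWith)
open import Data.List.Properties using (length-map)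
import Data.List.Membership.DecPropositional as DecMembership
open import Data.List.Membership.Propositional using (_∈_)
open import Data.List.Membership.Propositional.Properties using (∈-cartesianProductWith⁺)
open import Data.List.Relation.Unary.All as All using (All; all?)
open import Data.List.Relation.Unary.Any using (here)
open import Data.Nat as ℕ using (ℕ; zero; suc; _≤_; _<_; z≤n; s≤s; _≤′_; ≤′-refl; ≤′-step; NonZero)
import Data.Nat.Divisibility as ℕ
import Data.Nat.Properties as ℕ
open import Data.Product using (Σ-syntax; ∃-syntax; _×_; _,_; proj₁; proj₂)
open import Data.Sum using (_⊎_; inj₁; inj₂; [_,_]′)
open import Function using (_∘_; id; const)
open import Relation.Binary.Core using (_Preserves_⟶_)
open import Relation.Binary.Definitions using (DecidableEquality)
open import Relation.Binary.PropositionalEquality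
open import Relation.Nullary using (¬_; Dec; ¬?)
open import Relation.Nullary.Decidable using (map′; _×-dec_; dec⇒maybe; from-yes)
import Tactic.RingSolver as RingSolver
open import Tactic.RingSolver.Core.AlmostCommutativeRing
  using (AlmostCommutativeRing; fromCommutativeRing)

-- The ring ℤ[π]

tri-≡ : ∀ {a b c a′ b′ c′} → a ≡ a′ → b ≡ b′ → c ≡ c′ → tri a b c ≡ tri a′ b′ c′
tri-≡ refl refl refl = refl

-T_ : Tri → Tri
-T tri a b c = tri (- a) (- b) (- c)

+T-assoc : ∀ x y z → (x +T y) +T z ≡ x +T (y +T z)
+T-assoc (tri a b c) (tri d e f) (tri g h i) =
  tri-≡ (ℤ.+-assoc a d g) (ℤ.+-assoc b e h) (ℤ.+-assoc c f i)

+T-comm : ∀ x y → x +T y ≡ y +T x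
+T-comm (tri a b c) (tri d e f) = tri-≡ (ℤ.+-comm a d) (ℤ.+-comm b e) (ℤ.+-comm c f)

+T-identityˡ : ∀ x → 0T +T x ≡ x
+T-identityˡ (tri a b c) = tri-≡ (ℤ.+-identityˡ a) (ℤ.+-identityˡ b) (ℤ.+-identityˡ c)

+T-identityʳ : ∀ x → x +T 0T ≡ x
+T-identityʳ (tri a b c) = tri-≡ (ℤ.+-identityʳ a) (ℤ.+-identityʳ b) (ℤ.+-identityʳ c)

+T-inverseˡ : ∀ x → (-T x) +T x ≡ 0T
+T-inverseˡ (tri a b c) = tri-≡ (ℤ.+-inverseˡ a) (ℤ.+-inverseˡ b) (ℤ.+-inverseˡ c)

+T-inverseʳ : ∀ x → x +T (-T x) ≡ 0T
+T-inverseʳ (tri a b c) = tri-≡ (ℤ.+-inverseʳ a) (ℤ.+-inverseʳ b) (ℤ.+-inverseʳ c)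

*T-assoc : ∀ x y z → (x *T y) *T z ≡ x *T (y *T z)
*T-assoc (tri a b c) (tri d e f) (tri g h i) =
  tri-≡ (assoc₀ a b c d e f g h i) (assoc₁ a b c d e f g h i) (assoc₂ a b c d e f g h i)
  where
  assoc₀ : ∀ a b c d e f g h i →
    let A = a * d + + 2 * (b * f + c * e); B = a * e + b * d + + 2 * (c * f)
        C = a * f + b * e + c * d;         D = d * g + + 2 * (e * i + f * h)
        E = d * h + e * g + + 2 * (f * i); F = d * i + e * h + f * g
    in A * g + + 2 * (B * i + C * h) ≡ a * D + + 2 * (b * F + c * E)
  assoc₀ = solve-∀
  assoc₁ : ∀ a b c d e f g h i →
    let A = a * d + + 2 * (b * f + c * e); B = a * e + b * d + + 2 * (c * f)
        C = a * f + b * e + c * d;         D = d * g + + 2 * (e * i + f * h)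
        E = d * h + e * g + + 2 * (f * i); F = d * i + e * h + f * g
    in A * h + B * g + + 2 * (C * i) ≡ a * E + b * D + + 2 * (c * F)
  assoc₁ = solve-∀
  assoc₂ : ∀ a b c d e f g h i →
    let A = a * d + + 2 * (b * f + c * e); B = a * e + b * d + + 2 * (c * f)
        C = a * f + b * e + c * d;         D = d * g + + 2 * (e * i + f * h)
        E = d * h + e * g + + 2 * (f * i); F = d * i + e * h + f * g
    in A * i + B * h + C * g ≡ a * F + b * E + c * D
  assoc₂ = solve-∀

*T-comm : ∀ x y → x *T y ≡ y *T x
*T-comm (tri a b c) (tri d e f) =
  tri-≡ (comm₀ a b c d e f) (comm₁ a b c d e f) (comm₂ a b c d e f)
  where
  comm₀ : ∀ a b c d e f → a * d + + 2 * (b * f + c * e) ≡ d * a + + 2 * (e * c + f * b)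
  comm₀ = solve-∀
  comm₁ : ∀ a b c d e f → a * e + b * d + + 2 * (c * f) ≡ d * b + e * a + + 2 * (f * c)
  comm₁ = solve-∀
  comm₂ : ∀ a b c d e f → a * f + b * e + c * d ≡ d * c + e * b + f * a
  comm₂ = solve-∀

*T-identityˡ : ∀ x → 1T *T x ≡ x
*T-identityˡ (tri a b c) = tri-≡ (identity₀ a b c) (identity₁ a b c) (identity₂ a b c)
  where
  identity₀ : ∀ a b c → + 1 * a + + 2 * (+ 0 * c + + 0 * b) ≡ a
  identity₀ = solve-∀
  identity₁ : ∀ a b c → + 1 * b + + 0 * a + + 2 * (+ 0 * c) ≡ b
  identity₁ = solve-∀
  identity₂ : ∀ a b c → + 1 * c + + 0 * b + + 0 * a ≡ c
  identity₂ = solve-∀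

*T-identityʳ : ∀ x → x *T 1T ≡ x
*T-identityʳ x = trans (*T-comm x 1T) (*T-identityˡ x)

*T-distribʳ-+T : ∀ x y z → (y +T z) *T x ≡ (y *T x) +T (z *T x)
*T-distribʳ-+T (tri a b c) (tri d e f) (tri g h i) =
  tri-≡ (distrib₀ a b c d e f g h i) (distrib₁ a b c d e f g h i) (distrib₂ a b c d e f g h i)
  where
  distrib₀ : ∀ a b c d e f g h i →
    (d + g) * a + + 2 * ((e + h) * c + (f + i) * b)
    ≡ d * a + + 2 * (e * c + f * b) + (g * a + + 2 * (h * c + i * b))
  distrib₀ = solve-∀
  distrib₁ : ∀ a b c d e f g h i →
    (d + g) * b + (e + h) * a + + 2 * ((f + i) * c)
    ≡ d * b + e * a + + 2 * (f * c) + (g * b + h * a + + 2 * (i * c))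
  distrib₁ = solve-∀
  distrib₂ : ∀ a b c d e f g h i →
    (d + g) * c + (e + h) * b + (f + i) * a ≡ d * c + e * b + f * a + (g * c + h * b + i * a)
  distrib₂ = solve-∀

*T-distribˡ-+T : ∀ x y z → x *T (y +T z) ≡ (x *T y) +T (x *T z)
*T-distribˡ-+T x y z = begin
  x *T (y +T z)          ≡⟨ *T-comm x (y +T z) ⟩
  (y +T z) *T x          ≡⟨ *T-distribʳ-+T x y z ⟩
  (y *T x) +T (z *T x)   ≡⟨ cong₂ _+T_ (*T-comm y x) (*T-comm z x) ⟩
  (x *T y) +T (x *T z)   ∎
  where open ≡-Reasoning

ℤ[π] : CommutativeRing _ _
ℤ[π] = record
  { Carrier = Tri ; _≈_ = _≡_ ; _+_ = _+T_ ; _*_ = _*T_ ; -_ = -T_ ; 0# = 0T ; 1# = 1T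
  ; isCommutativeRing = record
    { isRing = record
      { +-isAbelianGroup = record
        { isGroup = record
          { isMonoid = record
            { isSemigroup = record
              { isMagma = record { isEquivalence = isEquivalence ; ∙-cong = cong₂ _+T_ }
              ; assoc = +T-assoc }
            ; identity = +T-identityˡ , +T-identityʳ }
          ; inverse = +T-inverseˡ , +T-inverseʳ
          ; ⁻¹-cong = cong -T_ }
        ; comm = +T-comm }
      ; *-cong = cong₂ _*T_
      ; *-assoc = *T-assoc
      ; *-identity = *T-identityˡ , *T-identityʳ
      ; distrib = *T-distribˡ-+T , *T-distribʳ-+T }
    ; *-comm = *T-comm } }

_≟T_ : DecidableEquality Tri
tri a b c ≟T tri d e f =
  map′ (λ { (refl , refl , refl) → refl }) (λ { refl → refl , refl , refl })
       (a ℤ.≟ d ×-dec b ℤ.≟ e ×-dec c ℤ.≟ f)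

ℤ[π]-solverRing : AlmostCommutativeRing _ _
ℤ[π]-solverRing = fromCommutativeRing ℤ[π] λ x → dec⇒maybe (0T ≟T x)

open AlmostCommutativeRing ℤ[π]-solverRing using (_^_)

open import Algebra.Properties.Semiring.Exp.TCOptimised (CommutativeRing.semiring ℤ[π])
  using (^-homo-*)

-- Congruences modulo powers of π

π : Tri
π = tri (+ 0) (+ 1) (+ 0)

π^-+ : ∀ m n → π ^ (m ℕ.+ n) ≡ (π ^ m) *T (π ^ n)
π^-+ = ^-homo-* π

^-suc : ∀ x n → x ^ suc n ≡ x *T (x ^ n)
^-suc x = ^-homo-* x 1

infix 4 _≡_[modπ^_]
record _≡_[modπ^_] (x y : Tri) (k : ℕ) : Set where
  constructor _,_
  field
    quotient : Tri
    equation : x ≡ y +T ((π ^ k) *T quotient)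

modπ-refl : ∀ {x k} → x ≡ x [modπ^ k ]
modπ-refl {x} {k} = 0T , identity x (π ^ k)
  where
  identity : ∀ x p → x ≡ x +T (p *T 0T)
  identity = RingSolver.solve-∀ ℤ[π]-solverRing

modπ-sym : ∀ {x y k} → x ≡ y [modπ^ k ] → y ≡ x [modπ^ k ]
modπ-sym {y = y} {k} (q , refl) = -T q , identity y (π ^ k) q
  where
  identity : ∀ y p q → y ≡ (y +T (p *T q)) +T (p *T (-T q))
  identity = RingSolver.solve-∀ ℤ[π]-solverRing

modπ-trans : ∀ {x y z k} → x ≡ y [modπ^ k ] → y ≡ z [modπ^ k ] → x ≡ z [modπ^ k ]
modπ-trans {z = z} {k} (q , refl) (q′ , refl) = q′ +T q , identity z (π ^ k) q q′
  where
  identity : ∀ z p q q′ → (z +T (p *T q′)) +T (p *T q) ≡ z +T (p *T (q′ +T q))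
  identity = RingSolver.solve-∀ ℤ[π]-solverRing

≡⇒modπ : ∀ {x y k} → x ≡ y → x ≡ y [modπ^ k ]
≡⇒modπ refl = modπ-refl

modπ-intro : ∀ {x y} m k q → x ≡ y +T (((π ^ m) *T (π ^ k)) *T q) → x ≡ y [modπ^ m ℕ.+ k ]
modπ-intro {y = y} m k q eq = q , trans eq (cong (λ p → y +T (p *T q)) (sym (π^-+ m k)))

modπ-weaken : ∀ {x y j k} → j ≤ k → x ≡ y [modπ^ k ] → x ≡ y [modπ^ j ]
modπ-weaken {y = y} {j} j≤k (q , refl) with ℕ.m≤n⇒∃[o]m+o≡n j≤k
... | d , refl = (π ^ d) *T q , cong (y +T_) (trans (cong (_*T q) (π^-+ j d)) (*T-assoc (π ^ j) (π ^ d) q))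

+-cong-modπ : ∀ {x x′ y y′ k} → x ≡ x′ [modπ^ k ] → y ≡ y′ [modπ^ k ] →
              x +T y ≡ x′ +T y′ [modπ^ k ]
+-cong-modπ {x′ = x′} {y′ = y′} {k} (a , refl) (b , refl) = a +T b , identity x′ y′ (π ^ k) a b
  where
  identity : ∀ x′ y′ p a b → (x′ +T (p *T a)) +T (y′ +T (p *T b)) ≡ (x′ +T y′) +T (p *T (a +T b))
  identity = RingSolver.solve-∀ ℤ[π]-solverRing

*-cong-modπ : ∀ {x x′ y y′ k} → x ≡ x′ [modπ^ k ] → y ≡ y′ [modπ^ k ] →
              x *T y ≡ x′ *T y′ [modπ^ k ]
*-cong-modπ {x′ = x′} {y′ = y′} {k} (a , refl) (b , refl) =
  ((a *T y′) +T (x′ *T b)) +T ((π ^ k) *T (a *T b)) , identity x′ y′ (π ^ k) a b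
  where
  identity : ∀ x′ y′ p a b → (x′ +T (p *T a)) *T (y′ +T (p *T b))
                        ≡ (x′ *T y′) +T (p *T (((a *T y′) +T (x′ *T b)) +T (p *T (a *T b))))
  identity = RingSolver.solve-∀ ℤ[π]-solverRing

^-cong-modπ : ∀ {x y k} n → x ≡ y [modπ^ k ] → x ^ n ≡ y ^ n [modπ^ k ]
^-cong-modπ zero          x≡y = modπ-refl
^-cong-modπ 1             x≡y = x≡y
^-cong-modπ (suc (suc n)) x≡y = *-cong-modπ (^-cong-modπ (suc n) x≡y) x≡y

module _ {z : ℕ → Tri} {g : ℕ → ℕ} (g-mono : g Preserves _≤_ ⟶ _≤_)
         (step : ∀ k → z (suc k) ≡ z k [modπ^ g k ]) where

  telescope-modπ : ∀ {k m} → k ≤ m → z m ≡ z k [modπ^ g k ]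
  telescope-modπ = go ∘ ℕ.≤⇒≤′
    where
    go : ∀ {k m} → k ≤′ m → z m ≡ z k [modπ^ g k ]
    go ≤′-refl          = modπ-refl
    go (≤′-step k≤′m) = modπ-trans (modπ-weaken (g-mono (ℕ.≤′⇒≤ k≤′m)) (step _)) (go k≤′m)

-- Parity and units

Even Odd : ℤ → Set
Even a = ∃[ q ] a ≡ + 2 * q
Odd  a = ∃[ q ] a ≡ + 1 + + 2 * q

parity : ∀ a → Even a ⊎ Odd a
parity a with a %ℕ 2 | n%ℕd<d a 2 | a≡a%ℕn+[a/ℕn]*n a 2
... | 0           | _                 | eq = inj₁ (a /ℕ 2 , trans eq (trans (ℤ.+-identityˡ _) (ℤ.*-comm (a /ℕ 2) (+ 2))))
... | 1           | _                 | eq = inj₂ (a /ℕ 2 , trans eq (cong (_+_ (+ 1)) (ℤ.*-comm (a /ℕ 2) (+ 2))))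
... | suc (suc _) | s≤s (s≤s ())      | _

odd+odd : ∀ {a b} → Odd a → Odd b → Even (a + b)
odd+odd (p , refl) (q , refl) = + 1 + p + q , identity p q
  where
  identity : ∀ p q → (+ 1 + + 2 * p) + (+ 1 + + 2 * q) ≡ + 2 * (+ 1 + p + q)
  identity = solve-∀

odd+even : ∀ {a b} → Odd a → Even b → Odd (a + b)
odd+even (p , refl) (q , refl) = p + q , identity p q
  where
  identity : ∀ p q → (+ 1 + + 2 * p) + + 2 * q ≡ + 1 + + 2 * (p + q)
  identity = solve-∀

Unit : Tri → Set
Unit t = Odd (c₀ t)

Unit-*T : ∀ {s t} → Unit s → Unit t → Unit (s *T t)
Unit-*T {tri _ b c} {tri _ e f} (p , refl) (q , refl) =
  p + q + + 2 * p * q + (b * f + c * e) , identity p q b c e f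
  where
  identity : ∀ p q b c e f → (+ 1 + + 2 * p) * (+ 1 + + 2 * q) + + 2 * (b * f + c * e)
                          ≡ + 1 + + 2 * (p + q + + 2 * p * q + (b * f + c * e))
  identity = solve-∀

Unit-^ : ∀ {t} n → Unit t → Unit (t ^ n)
Unit-^ zero              _ = + 0 , refl
Unit-^ 1                 u = u
Unit-^ {t} (suc (suc n)) u = Unit-*T {t ^ suc n} {t} (Unit-^ (suc n) u) u

π-*T : ∀ t → π *T t ≡ tri (+ 2 * c₂ t) (c₀ t) (c₁ t)
π-*T (tri a b c) = tri-≡ (coordinate₀ a b c) (coordinate₁ a b c) (coordinate₂ a b c)
  where
  coordinate₀ : ∀ a b c → + 0 * a + + 2 * (+ 1 * c + + 0 * b) ≡ + 2 * c
  coordinate₀ = solve-∀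
  coordinate₁ : ∀ a b c → + 0 * b + + 1 * a + + 2 * (+ 0 * c) ≡ a
  coordinate₁ = solve-∀
  coordinate₂ : ∀ a b c → + 0 * c + + 1 * b + + 0 * a ≡ b
  coordinate₂ = solve-∀

π-*T-even : ∀ t → Even (c₀ (π *T t))
π-*T-even t = c₂ t , cong c₀ (π-*T t)

even⇒π∣ : ∀ {t} → Even (c₀ t) → ∃[ w ] t ≡ π *T w
even⇒π∣ {t} (q , eq) = tri (c₁ t) (c₂ t) q , sym (trans (π-*T _) (tri-≡ (sym eq) refl refl))

modπ-suc : ∀ {x y k q} → x ≡ y +T ((π ^ k) *T q) → Even (c₀ q) → x ≡ y [modπ^ suc k ]
modπ-suc {y = y} {k} {q} x≡y+πᵏq q-even with even⇒π∣ {q} q-even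
... | w , refl = w , trans x≡y+πᵏq (cong (y +T_) (trans (identity (π ^ k) w) (cong (_*T w) (sym (^-suc π k)))))
  where
  identity : ∀ p w → p *T (π *T w) ≡ (π *T p) *T w
  identity = RingSolver.solve-∀ ℤ[π]-solverRing

-- Levels of R and congruences modulo π³ⁿ

ι : ℤ → Tri
ι a = tri a (+ 0) (+ 0)

ι-*T : ∀ a t → ι a *T t ≡ tri (a * c₀ t) (a * c₁ t) (a * c₂ t)
ι-*T a (tri u v w) = tri-≡ (coordinate₀ a u v w) (coordinate₁ a u v w) (coordinate₂ a u v w)
  where
  coordinate₀ : ∀ a u v w → a * u + + 2 * (+ 0 * w + + 0 * v) ≡ a * u
  coordinate₀ = solve-∀
  coordinate₁ : ∀ a u v w → a * v + + 0 * u + + 2 * (+ 0 * w) ≡ a * v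
  coordinate₁ = solve-∀
  coordinate₂ : ∀ a u v w → a * w + + 0 * v + + 0 * u ≡ a * w
  coordinate₂ = solve-∀

π³ⁿ : ∀ n → π ^ (3 ℕ.* n) ≡ ι (+ (2 ℕ.^ n))
π³ⁿ zero    = refl
π³ⁿ (suc n) = begin
  π ^ (3 ℕ.* suc n)              ≡⟨ cong (π ^_) (ℕ.*-suc 3 n) ⟩
  π ^ (3 ℕ.+ 3 ℕ.* n)            ≡⟨ π^-+ 3 (3 ℕ.* n) ⟩
  (π ^ 3) *T (π ^ (3 ℕ.* n))     ≡⟨ cong (ι (+ 2) *T_) (π³ⁿ n) ⟩
  ι (+ 2) *T ι (+ (2 ℕ.^ n))     ≡⟨ trans (ι-*T (+ 2) (ι (+ (2 ℕ.^ n)))) (cong ι (sym (ℤ.pos-* 2 (2 ℕ.^ n)))) ⟩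
  ι (+ (2 ℕ.^ suc n))            ∎
  where open ≡-Reasoning

modπ³ⁿ-intro : ∀ {x y} n q → x ≡ y +T (ι (+ (2 ℕ.^ n)) *T q) → x ≡ y [modπ^ 3 ℕ.* n ]
modπ³ⁿ-intro {y = y} n q eq = q , trans eq (cong (λ p → y +T (p *T q)) (sym (π³ⁿ n)))

mod2^⇒modπ³ⁿ : ∀ {x y n} → x ≈Tri y [mod2^ n ] → x ≡ y [modπ^ 3 ℕ.* n ]
mod2^⇒modπ³ⁿ {x} {y} {n} (d₀ , d₁ , d₂)
  with coordinate (c₀ x) (c₀ y) d₀ | coordinate (c₁ x) (c₁ y) d₁ | coordinate (c₂ x) (c₂ y) d₂
  where
  M = + (2 ℕ.^ n)
  coordinate : ∀ a b → M ∣ a - b → ∃[ q ] a ≡ b + M * q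
  coordinate a b d with ∣ᵤ⇒∣ {M} {a - b} d
  ... | divides q eq = q , (begin
    a              ≡⟨ identity a b ⟩
    b + (a - b)    ≡⟨ cong (_+_ b) (trans eq (ℤ.*-comm q M)) ⟩
    b + M * q      ∎)
    where
    open ≡-Reasoning
    identity : ∀ a b → a ≡ b + (a - b)
    identity = solve-∀
... | q₀ , e₀ | q₁ , e₁ | q₂ , e₂ =
  modπ³ⁿ-intro n (tri q₀ q₁ q₂)
    (trans (tri-≡ e₀ e₁ e₂) (cong (y +T_) (sym (ι-*T (+ (2 ℕ.^ n)) (tri q₀ q₁ q₂)))))

modπ³ⁿ⇒mod2^ : ∀ {x y n} → x ≡ y [modπ^ 3 ℕ.* n ] → x ≈Tri y [mod2^ n ]
modπ³ⁿ⇒mod2^ {x} {y} {n} (q , eq) =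
  divisible {m = M} (cong c₀ eq′) , divisible {m = M} (cong c₁ eq′) , divisible {m = M} (cong c₂ eq′)
  where
  M = + (2 ℕ.^ n)
  eq′ : x ≡ y +T tri (M * c₀ q) (M * c₁ q) (M * c₂ q)
  eq′ = trans eq (cong (y +T_) (trans (cong (_*T q) (π³ⁿ n)) (ι-*T M q)))
  divisible : ∀ {a b m q} → a ≡ b + m * q → m ∣ a - b
  divisible {b = b} {m} {q} refl = ∣⇒∣ᵤ (divides q (identity b m q))
    where
    identity : ∀ b m q → b + m * q - b ≡ q * m
    identity = solve-∀

valid-coherent : ∀ {r} → Valid r → ∀ {n m} → n ≤ m → r m ≡ r n [modπ^ 3 ℕ.* n ]
valid-coherent r-valid = telescope-modπ (ℕ.*-monoʳ-≤ 3) (λ k → mod2^⇒modπ³ⁿ {n = k} (r-valid k))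

limit-valid : ∀ {z : ℕ → Tri} → (∀ k → z (suc k) ≡ z k [modπ^ k ]) → Valid (λ n → z (3 ℕ.* n))
limit-valid step n = modπ³ⁿ⇒mod2^ {n = n} (telescope-modπ id step (ℕ.*-monoʳ-≤ 3 (ℕ.n≤1+n n)))

^R-pointwise : ∀ x k n → (x ^R k) n ≡ x n ^ k
^R-pointwise x zero    n = refl
^R-pointwise x (suc k) n = trans (cong (x n *T_) (^R-pointwise x k n)) (sym (^-suc (x n) k))

-- Hensel's lemma for sixth powers

binomial-mod-square : ∀ n z h → ∃[ Q ]
  (z +T h) ^ suc n ≡ ((z ^ suc n) +T ((ι (+ suc n) *T (z ^ n)) *T h)) +T ((h *T h) *T Q)
binomial-mod-square zero z h = 0T , identity z h
  where
  identity : ∀ z h → (z +T h) ^ 1 ≡ ((z ^ 1) +T ((ι (+ 1) *T (z ^ 0)) *T h)) +T ((h *T h) *T 0T)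
  identity = RingSolver.solve-∀ ℤ[π]-solverRing
binomial-mod-square (suc n) z h =
  let Q , expansion = binomial-mod-square n z h in
  (ι (+ suc n) *T (z ^ n)) +T ((Q *T z) +T (Q *T h)) ,
  step {(z +T h) ^ suc n} {z ^ suc n} (z ^ n) (ι (+ suc n)) Q expansion (^-sucʳ n)
  where
  ^-sucʳ : ∀ n → z ^ suc n ≡ (z ^ n) *T z
  ^-sucʳ zero    = sym (*T-identityˡ z)
  ^-sucʳ (suc n) = refl
  identity : ∀ z h A C Q →
    (((A *T z) +T ((C *T A) *T h)) +T ((h *T h) *T Q)) *T (z +T h)
    ≡ (((A *T z) *T z) +T (((1T +T C) *T (A *T z)) *T h))
      +T ((h *T h) *T ((C *T A) +T ((Q *T z) +T (Q *T h))))
  identity = RingSolver.solve-∀ ℤ[π]-solverRing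
  step : ∀ {E B} A C Q → E ≡ (B +T ((C *T A) *T h)) +T ((h *T h) *T Q) → B ≡ A *T z →
    E *T (z +T h)
    ≡ ((B *T z) +T (((1T +T C) *T B) *T h)) +T ((h *T h) *T ((C *T A) +T ((Q *T z) +T (Q *T h))))
  step A C Q refl refl = identity z h A C Q

-- Since 6 = π³ · 3, (z + π⁴p)⁶ ≡ z⁶ + π⁷p · 3z⁵ modulo π⁸p: adding π⁴p to z absorbs an
-- error π⁷p · a in z⁶ as soon as a + 3z⁵ is divisible by π.
sixth-power-correction : ∀ {E z⁶} {z⁵ r a w p Q} →
  E ≡ (z⁶ +T ((ι (+ 6) *T z⁵) *T ((π ^ 4) *T p))) +T ((((π ^ 4) *T p) *T ((π ^ 4) *T p)) *T Q) →
  z⁶ ≡ r +T (((π ^ 7) *T p) *T a) →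
  a ≡ (π *T w) +T (-T (ι (+ 3) *T z⁵)) →
  E ≡ r +T (((π ^ 8) *T p) *T (w +T (p *T Q)))
sixth-power-correction {z⁵ = z⁵} {r} {w = w} {p} {Q} refl refl refl = identity z⁵ r w p Q
  where
  identity : ∀ z⁵ r w p Q →
    ((r +T (((π ^ 7) *T p) *T ((π *T w) +T (-T (ι (+ 3) *T z⁵)))))
      +T ((ι (+ 6) *T z⁵) *T ((π ^ 4) *T p)))
      +T ((((π ^ 4) *T p) *T ((π ^ 4) *T p)) *T Q)
    ≡ r +T (((π ^ 8) *T p) *T (w +T (p *T Q)))
  identity = RingSolver.solve-∀ ℤ[π]-solverRing

x+y≡z⇒x≡z-y : ∀ {x y t} → x +T y ≡ t → x ≡ t +T (-T y)
x+y≡z⇒x≡z-y {x} {y} refl = identity x y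
  where
  identity : ∀ x y → x ≡ (x +T y) +T (-T y)
  identity = RingSolver.solve-∀ ℤ[π]-solverRing

π⁴-*T-even : ∀ p → Even (c₀ ((π ^ 4) *T p))
π⁴-*T-even p = subst (Even ∘ c₀) (sym (identity p)) (π-*T-even ((π ^ 3) *T p))
  where
  identity : ∀ p → (π ^ 4) *T p ≡ π *T ((π ^ 3) *T p)
  identity = RingSolver.solve-∀ ℤ[π]-solverRing

sixth-power-lift : ∀ k {z r} → Unit z → z ^ 6 ≡ r [modπ^ 7 ℕ.+ k ] →
                   Σ[ z′ ∈ Tri ] Unit z′ × z′ ≡ z [modπ^ 4 ℕ.+ k ] × z′ ^ 6 ≡ r [modπ^ 8 ℕ.+ k ]
sixth-power-lift k {z} {r} z-unit (a , z⁶≡r+πa) = [ keep , correct ]′ (parity (c₀ a))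
  where
  keep : Even (c₀ a) →
         Σ[ z′ ∈ Tri ] Unit z′ × z′ ≡ z [modπ^ 4 ℕ.+ k ] × z′ ^ 6 ≡ r [modπ^ 8 ℕ.+ k ]
  keep a-even = z , z-unit , modπ-refl , modπ-suc z⁶≡r+πa a-even
  correct : Odd (c₀ a) →
            Σ[ z′ ∈ Tri ] Unit z′ × z′ ≡ z [modπ^ 4 ℕ.+ k ] × z′ ^ 6 ≡ r [modπ^ 8 ℕ.+ k ]
  correct a-odd =
    z +T ((π ^ 4) *T (π ^ k)) ,
    odd+even z-unit (π⁴-*T-even (π ^ k)) ,
    modπ-intro 4 k 1T (cong (z +T_) (sym (*T-identityʳ ((π ^ 4) *T (π ^ k))))) ,
    modπ-intro 8 k (proj₁ w +T ((π ^ k) *T proj₁ Q))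
      (sixth-power-correction {z⁵ = z ^ 5} {r} {a} {proj₁ w} {π ^ k} {proj₁ Q} (proj₂ Q)
        (subst (λ u → z ^ 6 ≡ r +T (u *T a)) (π^-+ 7 k) z⁶≡r+πa)
        (x+y≡z⇒x≡z-y {a} {ι (+ 3) *T (z ^ 5)} (proj₂ w)))
    where
    Q = binomial-mod-square 5 z ((π ^ 4) *T (π ^ k))
    w = even⇒π∣ {a +T (ι (+ 3) *T (z ^ 5))}
          (odd+odd a-odd (Unit-*T {ι (+ 3)} {z ^ 5} (+ 1 , refl) (Unit-^ 5 z-unit)))

module _ (t : ℕ → Tri) (t-step : ∀ k → t (suc k) ≡ t k [modπ^ 7 ℕ.+ k ]) where

  SixthRootApproximation : ℕ → Set
  SixthRootApproximation k = Σ[ z ∈ Tri ] Unit z × z ^ 6 ≡ t k [modπ^ 7 ℕ.+ k ]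

  refine : ∀ {k} (a : SixthRootApproximation k) →
           Σ[ a′ ∈ SixthRootApproximation (suc k) ] proj₁ a′ ≡ proj₁ a [modπ^ 4 ℕ.+ k ]
  refine {k} (z , z-unit , z⁶≡tₖ) =
    let z′ , z′-unit , z′≡z , z′⁶≡tₖ₊₁ =
          sixth-power-lift k z-unit (modπ-trans z⁶≡tₖ (modπ-sym (t-step k)))
    in (z′ , z′-unit , z′⁶≡tₖ₊₁) , z′≡z

  approximations : SixthRootApproximation 0 → ∀ k → SixthRootApproximation k
  approximations a₀ zero    = a₀
  approximations a₀ (suc k) = proj₁ (refine (approximations a₀ k))

sixth-root : ∀ {r} → Valid r → ∀ {b} → Unit b → b ^ 6 ≡ r 7 [modπ^ 7 ] →
             Σ[ x ∈ R ] Valid x × (x ^R 6) ≈ r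
sixth-root {r} r-valid {b} b-unit b⁶≡r₇ = x , limit-valid {λ k → proj₁ (a k)} step , x⁶≈r
  where
  t : ℕ → Tri
  t k = r (7 ℕ.+ k)
  t-step : ∀ k → t (suc k) ≡ t k [modπ^ 7 ℕ.+ k ]
  t-step k = modπ-weaken (ℕ.m≤n*m (7 ℕ.+ k) 3) (mod2^⇒modπ³ⁿ {n = 7 ℕ.+ k} (r-valid (7 ℕ.+ k)))
  a : ∀ k → SixthRootApproximation t t-step k
  a = approximations t t-step (b , b-unit , b⁶≡r₇)
  step : ∀ k → proj₁ (a (suc k)) ≡ proj₁ (a k) [modπ^ k ]
  step k = modπ-weaken (ℕ.m≤n+m k 4) (proj₂ (refine t t-step (a k)))
  x : R
  x n = proj₁ (a (3 ℕ.* n))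
  x⁶≈r : (x ^R 6) ≈ r
  x⁶≈r n = modπ³ⁿ⇒mod2^ {n = n} (modπ-trans (≡⇒modπ (^R-pointwise x 6 n))
             (modπ-trans (modπ-weaken (ℕ.m≤n+m (3 ℕ.* n) 7) (proj₂ (proj₂ (a (3 ℕ.* n)))))
                         (valid-coherent {r} r-valid (ℕ.≤-trans (ℕ.m≤n*m n 3) (ℕ.m≤n+m (3 ℕ.* n) 7)))))

-- Sums of at most six sixth powers

Even-c₁ : Tri → Set
Even-c₁ t = Even (c₁ t)

Even-c₁-+T : ∀ {s t} → Even-c₁ s → Even-c₁ t → Even-c₁ (s +T t)
Even-c₁-+T (p , eq) (q , eq′) = p + q , trans (cong₂ _+_ eq eq′) (sym (ℤ.*-distribˡ-+ (+ 2) p q))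

Even-c₁-*T : ∀ {s t} → Even-c₁ s → Even-c₁ t → Even-c₁ (s *T t)
Even-c₁-*T {tri a _ c} {tri d _ f} (p , refl) (q , refl) =
  a * q + p * d + c * f , identity a c d f p q
  where
  identity : ∀ a c d f p q → a * (+ 2 * q) + + 2 * p * d + + 2 * (c * f) ≡ + 2 * (a * q + p * d + c * f)
  identity = solve-∀

Even-c₁-square : ∀ t → Even-c₁ (t *T t)
Even-c₁-square (tri a b c) = a * b + c * c , identity a b c
  where
  identity : ∀ a b c → a * b + b * a + + 2 * (c * c) ≡ + 2 * (a * b + c * c)
  identity = solve-∀

Even-c₁-^ : ∀ {t} n → Even-c₁ t → Even-c₁ (t ^ n)
Even-c₁-^ zero              _ = + 0 , refl
Even-c₁-^ 1                 e = e
Even-c₁-^ {t} (suc (suc n)) e = Even-c₁-*T {t ^ suc n} {t} (Even-c₁-^ (suc n) e) e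

sixth-power-as-cube : ∀ t → t ^ 6 ≡ (t *T t) ^ 3
sixth-power-as-cube = RingSolver.solve-∀ ℤ[π]-solverRing

Even-c₁-sixth-power : ∀ t → Even-c₁ (t ^ 6)
Even-c₁-sixth-power t = subst Even-c₁ (sym (sixth-power-as-cube t)) (Even-c₁-^ {t *T t} 3 (Even-c₁-square t))

Even-c₁-sumPow : ∀ xs n → Even-c₁ (sumPow 6 xs n)
Even-c₁-sumPow []       n = + 0 , refl
Even-c₁-sumPow (x ∷ xs) n =
  Even-c₁-+T {(x ^R 6) n} {sumPow 6 xs n}
    (subst Even-c₁ (sym (^R-pointwise x 6 n)) (Even-c₁-sixth-power (x n))) (Even-c₁-sumPow xs n)

Even-c₁-modπ³ : ∀ {x y} → x ≡ y [modπ^ 3 ] → Even-c₁ y → Even-c₁ x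
Even-c₁-modπ³ {y = tri a _ c} (tri u v w , refl) (e , refl) =
  e + v , identity e u v w
  where
  identity : ∀ e u v w → + 2 * e + (+ 2 * v + + 0 * u + + 2 * (+ 0 * w)) ≡ + 2 * (e + v)
  identity = solve-∀

divmod : ∀ a m .{{_ : NonZero m}} → a ≡ + (a %ℕ m) + + m * (a /ℕ m)
divmod a m = trans (a≡a%ℕn+[a/ℕn]*n a m) (cong (_+_ (+ (a %ℕ m))) (ℤ.*-comm (a /ℕ m) (+ m)))

-- π⁷ = 4π
π⁷-*T : ∀ t → tri (+ 0) (+ 4) (+ 0) *T t ≡ tri (+ 8 * c₂ t) (+ 4 * c₀ t) (+ 4 * c₁ t)
π⁷-*T (tri a b c) = tri-≡ (coordinate₀ a b c) (coordinate₁ a b c) (coordinate₂ a b c)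
  where
  coordinate₀ : ∀ a b c → + 0 * a + + 2 * (+ 4 * c + + 0 * b) ≡ + 8 * c
  coordinate₀ = solve-∀
  coordinate₁ : ∀ a b c → + 0 * b + + 4 * a + + 2 * (+ 0 * c) ≡ + 4 * a
  coordinate₁ = solve-∀
  coordinate₂ : ∀ a b c → + 0 * c + + 4 * b + + 0 * a ≡ + 4 * b
  coordinate₂ = solve-∀

modπ⁷-intro : ∀ {x y} u v w → c₀ x ≡ c₀ y + + 8 * u → c₁ x ≡ c₁ y + + 4 * v →
              c₂ x ≡ c₂ y + + 4 * w → x ≡ y [modπ^ 7 ]
modπ⁷-intro {y = y} u v w e₀ e₁ e₂ =
  tri v w u , trans (tri-≡ e₀ e₁ e₂) (cong (y +T_) (sym (π⁷-*T (tri v w u))))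

residue₇ : Tri → Tri
residue₇ t = tri (+ (c₀ t %ℕ 8)) (+ (c₁ t %ℕ 4)) (+ (c₂ t %ℕ 4))

≡-residue₇ : ∀ t → t ≡ residue₇ t [modπ^ 7 ]
≡-residue₇ t = modπ⁷-intro (c₀ t /ℕ 8) (c₁ t /ℕ 4) (c₂ t /ℕ 4)
                           (divmod (c₀ t) 8) (divmod (c₁ t) 4) (divmod (c₂ t) 4)

representative : ℕ → ℕ → ℕ → Tri
representative i j k = tri (+ i) (+ 2 * + j) (+ k)

even-c₁-residue : ∀ {y q} → c₁ y ≡ + 2 * q →
                  y ≡ representative (c₀ y %ℕ 8) (q %ℕ 2) (c₂ y %ℕ 4) [modπ^ 7 ]
even-c₁-residue {y} {q} c₁≡2q =
  modπ⁷-intro (c₀ y /ℕ 8) (q /ℕ 2) (c₂ y /ℕ 4) (divmod (c₀ y) 8)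
    (trans c₁≡2q (trans (cong (_*_ (+ 2)) (divmod q 2)) (identity (+ (q %ℕ 2)) (q /ℕ 2))))
    (divmod (c₂ y) 4)
  where
  identity : ∀ j b → + 2 * (j + + 2 * b) ≡ + 2 * j + + 4 * b
  identity = solve-∀

sixthPowerSum : List Tri → Tri
sixthPowerSum []       = 0T
sixthPowerSum (c ∷ cs) = (c ^ 6) +T sixthPowerSum cs

sumPow-const : ∀ cs n → sumPow 6 (map const cs) n ≡ sixthPowerSum cs
sumPow-const []       n = refl
sumPow-const (c ∷ cs) n = cong₂ _+T_ (^R-pointwise (const c) 6 n) (sumPow-const cs n)

valid-+T-const : ∀ {y} → Valid y → ∀ c → Valid (λ n → y n +T c)
valid-+T-const {y} y-valid c n =
  modπ³ⁿ⇒mod2^ {y (suc n) +T c} {y n +T c} {n}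
    (+-cong-modπ {y (suc n)} {y n} {c} {c} (mod2^⇒modπ³ⁿ {y (suc n)} {y n} {n} (y-valid n)) modπ-refl)

const-valid : ∀ c → Valid (const c)
const-valid c n = modπ³ⁿ⇒mod2^ {c} {c} {n} modπ-refl

const-allValid : ∀ cs → AllValid (map const cs)
const-allValid []       = _
const-allValid (c ∷ cs) = const-valid c , const-allValid cs

1+π 1+π² 1+π+π² : Tri
1+π    = tri (+ 1) (+ 1) (+ 0)
1+π²   = tri (+ 1) (+ 0) (+ 1)
1+π+π² = tri (+ 1) (+ 1) (+ 1)

-- Witnesses for Decomposes (representative i j k), one for each class modulo π⁷ with even c₁.
table : ℕ → ℕ → ℕ → List Tri × Tri
table 0 0 0 = π ∷ 1T ∷ 1T ∷ 1T ∷ [] , 1T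
table 0 0 1 = 1T ∷ 1+π ∷ 1+π ∷ [] , 1+π
table 0 0 2 = 1T ∷ 1+π² ∷ 1+π ∷ [] , 1+π+π²
table 0 0 3 = 1T ∷ 1T ∷ 1T ∷ [] , 1+π
table 0 1 0 = 1T ∷ 1T ∷ 1+π ∷ [] , 1+π+π²
table 0 1 1 = 1T ∷ 1T ∷ 1+π² ∷ [] , 1+π
table 0 1 2 = 1+π ∷ 1+π ∷ 1+π ∷ [] , 1+π+π²
table 0 1 3 = 1+π² ∷ 1+π ∷ 1+π ∷ [] , 1+π
table 1 0 0 = [] , 1T
table 1 0 1 = 1T ∷ 1T ∷ 1+π ∷ 1+π ∷ [] , 1+π
table 1 0 2 = 1T ∷ 1T ∷ 1+π² ∷ 1+π ∷ [] , 1+π+π²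
table 1 0 3 = π ∷ [] , 1+π
table 1 1 0 = 1T ∷ 1T ∷ 1T ∷ 1+π ∷ [] , 1+π+π²
table 1 1 1 = [] , 1+π+π²
table 1 1 2 = [] , 1+π²
table 1 1 3 = 1T ∷ 1+π² ∷ 1+π ∷ 1+π ∷ [] , 1+π
table 2 0 0 = 1T ∷ [] , 1T
table 2 0 1 = 1T ∷ 1T ∷ 1T ∷ 1+π ∷ 1+π ∷ [] , 1+π
table 2 0 2 = 1+π ∷ [] , 1+π
table 2 0 3 = 1+π² ∷ [] , 1+π+π²
table 2 1 0 = π ∷ 1+π ∷ [] , 1+π+π²
table 2 1 1 = 1T ∷ [] , 1+π+π²
table 2 1 2 = 1T ∷ [] , 1+π²
table 2 1 3 = 1T ∷ 1T ∷ 1+π² ∷ 1+π ∷ 1+π ∷ [] , 1+π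
table 3 0 0 = 1T ∷ 1T ∷ [] , 1T
table 3 0 1 = π ∷ 1+π ∷ 1+π ∷ [] , 1+π
table 3 0 2 = 1T ∷ 1+π ∷ [] , 1+π
table 3 0 3 = 1T ∷ 1+π² ∷ [] , 1+π+π²
table 3 1 0 = 1+π² ∷ 1+π ∷ [] , 1+π
table 3 1 1 = 1T ∷ 1T ∷ [] , 1+π+π²
table 3 1 2 = 1T ∷ 1T ∷ [] , 1+π²
table 3 1 3 = 1+π ∷ 1+π ∷ [] , 1+π+π²
table 4 0 0 = 1T ∷ 1T ∷ 1T ∷ [] , 1T
table 4 0 1 = 1+π² ∷ 1+π ∷ 1+π ∷ [] , 1+π+π²
table 4 0 2 = 1T ∷ 1T ∷ 1+π ∷ [] , 1+π
table 4 0 3 = 1T ∷ 1T ∷ 1+π² ∷ [] , 1+π+π²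
table 4 1 0 = 1T ∷ 1+π² ∷ 1+π ∷ [] , 1+π
table 4 1 1 = 1T ∷ 1T ∷ 1T ∷ [] , 1+π+π²
table 4 1 2 = 1T ∷ 1T ∷ 1T ∷ [] , 1+π²
table 4 1 3 = 1T ∷ 1+π ∷ 1+π ∷ [] , 1+π+π²
table 5 0 0 = π ∷ [] , 1T
table 5 0 1 = 1T ∷ 1+π² ∷ 1+π ∷ 1+π ∷ [] , 1+π+π²
table 5 0 2 = 1T ∷ 1T ∷ 1T ∷ 1+π ∷ [] , 1+π
table 5 0 3 = [] , 1+π
table 5 1 0 = 1T ∷ 1T ∷ 1+π² ∷ 1+π ∷ [] , 1+π
table 5 1 1 = π ∷ [] , 1+π+π²
table 5 1 2 = π ∷ [] , 1+π²
table 5 1 3 = 1T ∷ 1T ∷ 1+π ∷ 1+π ∷ [] , 1+π+π²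
table 6 0 0 = π ∷ 1T ∷ [] , 1T
table 6 0 1 = 1T ∷ 1T ∷ 1+π² ∷ 1+π ∷ 1+π ∷ [] , 1+π+π²
table 6 0 2 = π ∷ 1+π ∷ [] , 1+π
table 6 0 3 = 1T ∷ [] , 1+π
table 6 1 0 = 1+π ∷ [] , 1+π+π²
table 6 1 1 = 1+π² ∷ [] , 1+π
table 6 1 2 = π ∷ 1T ∷ [] , 1+π²
table 6 1 3 = 1T ∷ 1T ∷ 1T ∷ 1+π ∷ 1+π ∷ [] , 1+π+π²
table 7 0 0 = π ∷ 1T ∷ 1T ∷ [] , 1T
table 7 0 1 = 1+π ∷ 1+π ∷ [] , 1+π
table 7 0 2 = 1+π² ∷ 1+π ∷ [] , 1+π+π²
table 7 0 3 = 1T ∷ 1T ∷ [] , 1+π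
table 7 1 0 = 1T ∷ 1+π ∷ [] , 1+π+π²
table 7 1 1 = 1T ∷ 1+π² ∷ [] , 1+π
table 7 1 2 = π ∷ 1T ∷ 1T ∷ [] , 1+π²
table 7 1 3 = π ∷ 1+π ∷ 1+π ∷ [] , 1+π+π²
table _ _ _ = [] , 1T

Decomposes : Tri → List Tri × Tri → Set
Decomposes ρ (cs , b) = c₀ b ≡ + 1 × length cs ≤ 5 × residue₇ ((b ^ 6) +T sixthPowerSum cs) ≡ ρ

decomposes? : ∀ ρ d → Dec (Decomposes ρ d)
decomposes? ρ (cs , b) =
  c₀ b ℤ.≟ + 1 ×-dec length cs ℕ.≤? 5 ×-dec residue₇ ((b ^ 6) +T sixthPowerSum cs) ≟T ρ

table-decomposes : ∀ {i} → i < 8 → ∀ {j} → j < 2 → ∀ {k} → k < 4 →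
                   Decomposes (representative i j k) (table i j k)
table-decomposes = from-yes (ℕ.allUpTo? (λ i → ℕ.allUpTo? (λ j → ℕ.allUpTo? (λ k →
  decomposes? (representative i j k) (table i j k)) 4) 2) 8)

decomposition⇒sum-of-six : ∀ {y ρ} → Valid y → y 3 ≡ ρ [modπ^ 7 ] →
                           ∀ d → Decomposes ρ d → SumOfAtMost 6 6 y
decomposition⇒sum-of-six {y} y-valid y₃≡ρ (cs , b) (b₀≡1 , |cs|≤5 , residue≡ρ) =
  x ∷ map const cs , (x-valid , const-allValid cs) ,
  s≤s (ℕ.≤-trans (ℕ.≤-reflexive (length-map const cs)) |cs|≤5) , sum≈y
  where
  C = sixthPowerSum cs
  r : R
  r n = y n +T (-T C)
  r-valid : Valid r
  r-valid = valid-+T-const {y} y-valid (-T C)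
  b⁶+C≡y₇ : (b ^ 6) +T C ≡ y 7 [modπ^ 7 ]
  b⁶+C≡y₇ = modπ-trans (≡-residue₇ ((b ^ 6) +T C))
              (subst (λ ρ′ → ρ′ ≡ y 7 [modπ^ 7 ]) (sym residue≡ρ)
                     (modπ-sym (modπ-trans (modπ-weaken (ℕ.m≤n+m 7 2)
                                                        (valid-coherent {y} y-valid (ℕ.m≤n+m 3 4)))
                                           y₃≡ρ)))
  b⁶≡r₇ : b ^ 6 ≡ r 7 [modπ^ 7 ]
  b⁶≡r₇ = modπ-trans (≡⇒modπ (x+y≡z⇒x≡z-y {b ^ 6} {C} refl))
                     (+-cong-modπ {(b ^ 6) +T C} {y 7} { -T C} { -T C} b⁶+C≡y₇ modπ-refl)
  root = sixth-root {r} r-valid {b} (+ 0 , b₀≡1) b⁶≡r₇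
  x = proj₁ root
  x-valid = proj₁ (proj₂ root)
  sum≈y : sumPow 6 (x ∷ map const cs) ≈ y
  sum≈y n = modπ³ⁿ⇒mod2^ {(x ^R 6) n +T sumPow 6 (map const cs) n} {y n} {n}
    (modπ-trans (+-cong-modπ {(x ^R 6) n} {r n} {sumPow 6 (map const cs) n} {C}
                             (mod2^⇒modπ³ⁿ {(x ^R 6) n} {r n} {n} (proj₂ (proj₂ root) n))
                             (≡⇒modπ (sumPow-const cs n)))
                (≡⇒modπ (cancel (y n) C)))
    where
    cancel : ∀ y C → (y +T (-T C)) +T C ≡ y
    cancel = RingSolver.solve-∀ ℤ[π]-solverRing

even-c₁⇒sum-of-six : ∀ {y} → Valid y → Even-c₁ (y 3) → SumOfAtMost 6 6 y
even-c₁⇒sum-of-six {y} y-valid (q , c₁≡2q) =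
  decomposition⇒sum-of-six y-valid (even-c₁-residue {y 3} c₁≡2q)
    (table (c₀ (y 3) %ℕ 8) (q %ℕ 2) (c₂ (y 3) %ℕ 4))
    (table-decomposes (n%ℕd<d (c₀ (y 3)) 8) (n%ℕd<d q 2) (n%ℕd<d (c₂ (y 3)) 4))

sixth-power-sums-need-at-most-six : WaringBound 6 6
sixth-power-sums-need-at-most-six y y-valid (xs , _ , _ , Σ≈y) =
  even-c₁⇒sum-of-six y-valid
    (Even-c₁-modπ³ {y 3} {sumPow 6 xs 3}
       (modπ-weaken (ℕ.m≤n*m 3 3) (modπ-sym (mod2^⇒modπ³ⁿ {n = 3} (Σ≈y 3))))
       (Even-c₁-sumPow xs 3))

-- Sixth powers modulo 4

reduce-mod2^ : ℕ → Tri → Tri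
reduce-mod2^ n t = tri (remainder (c₀ t)) (remainder (c₁ t)) (remainder (c₂ t))
  where
  instance
    2ⁿ≢0 : NonZero (2 ℕ.^ n)
    2ⁿ≢0 = ℕ.m^n≢0 2 n
  remainder : ℤ → ℤ
  remainder a = + (a %ℕ 2 ℕ.^ n)

≡-reduce-mod2^ : ∀ n t → t ≡ reduce-mod2^ n t [modπ^ 3 ℕ.* n ]
≡-reduce-mod2^ n t =
  modπ³ⁿ-intro n q (trans (tri-≡ (divmod (c₀ t) M) (divmod (c₁ t) M) (divmod (c₂ t) M))
                         (cong (reduce-mod2^ n t +T_) (sym (ι-*T (+ M) q))))
  where
  M = 2 ℕ.^ n
  instance
    2ⁿ≢0 : NonZero M
    2ⁿ≢0 = ℕ.m^n≢0 2 n
  q = tri (c₀ t /ℕ M) (c₁ t /ℕ M) (c₂ t /ℕ M)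

-- Since 2 = π³, squaring doubles the precision of a congruence modulo 2.
square-cong-modπ : ∀ {x y} k → x ≡ y [modπ^ 3 ℕ.+ k ] → x *T x ≡ y *T y [modπ^ 6 ℕ.+ k ]
square-cong-modπ {y = y} k (q , refl) =
  modπ-intro 6 k ((y *T q) +T ((π ^ k) *T (q *T q)))
    (subst (λ u → (y +T (u *T q)) *T (y +T (u *T q))
                  ≡ (y *T y) +T (((π ^ 6) *T (π ^ k)) *T ((y *T q) +T ((π ^ k) *T (q *T q)))))
           (sym (π^-+ 3 k)) (identity y (π ^ k) q))
  where
  identity : ∀ y p q →
    (y +T (((π ^ 3) *T p) *T q)) *T (y +T (((π ^ 3) *T p) *T q))
    ≡ (y *T y) +T (((π ^ 6) *T p) *T ((y *T q) +T (p *T (q *T q))))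
  identity = RingSolver.solve-∀ ℤ[π]-solverRing

sixth-power-cong-modπ : ∀ {x y} → x ≡ y [modπ^ 3 ] → x ^ 6 ≡ y ^ 6 [modπ^ 6 ]
sixth-power-cong-modπ {x} {y} x≡y =
  subst₂ (λ u v → u ≡ v [modπ^ 6 ]) (sym (sixth-power-as-cube x)) (sym (sixth-power-as-cube y))
         (^-cong-modπ 3 (square-cong-modπ 0 x≡y))

sixthPowersMod4 : List Tri
sixthPowersMod4 =
  0T ∷ 1T ∷ tri (+ 1) (+ 2) (+ 2) ∷ tri (+ 1) (+ 0) (+ 3) ∷ tri (+ 1) (+ 2) (+ 1) ∷ []

open DecMembership _≟T_ using (_∈?_)

sixth-powers-of-residues-mod2 : ∀ {a} → a < 2 → ∀ {b} → b < 2 → ∀ {c} → c < 2 →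
  reduce-mod2^ 2 (tri (+ a) (+ b) (+ c) ^ 6) ∈ sixthPowersMod4
sixth-powers-of-residues-mod2 = from-yes (ℕ.allUpTo? (λ a → ℕ.allUpTo? (λ b → ℕ.allUpTo? (λ c →
  reduce-mod2^ 2 (tri (+ a) (+ b) (+ c) ^ 6) ∈? sixthPowersMod4) 2) 2) 2)

sixth-power-mod4 : ∀ t → ∃[ s ] s ∈ sixthPowersMod4 × t ^ 6 ≡ s [modπ^ 6 ]
sixth-power-mod4 t =
  reduce-mod2^ 2 (reduce-mod2^ 1 t ^ 6) ,
  subst (λ u → reduce-mod2^ 2 (u ^ 6) ∈ sixthPowersMod4) residue-mod2
        (sixth-powers-of-residues-mod2 (n%ℕd<d (c₀ t) 2) (n%ℕd<d (c₁ t) 2) (n%ℕd<d (c₂ t) 2)) ,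
  modπ-trans (sixth-power-cong-modπ (≡-reduce-mod2^ 1 t)) (≡-reduce-mod2^ 2 (reduce-mod2^ 1 t ^ 6))
  where
  residue-mod2 : tri (+ (c₀ t %ℕ 2)) (+ (c₁ t %ℕ 2)) (+ (c₂ t %ℕ 2)) ≡ reduce-mod2^ 1 t
  residue-mod2 = refl

sumsMod4 : ℕ → List Tri
sumsMod4 zero    = 0T ∷ []
sumsMod4 (suc k) = cartesianProductWith (λ s u → reduce-mod2^ 2 (s +T u)) sixthPowersMod4 (sumsMod4 k)

0∈sumsMod4 : ∀ k → 0T ∈ sumsMod4 k
0∈sumsMod4 zero    = here refl
0∈sumsMod4 (suc k) =
  ∈-cartesianProductWith⁺ (λ s u → reduce-mod2^ 2 (s +T u)) {sixthPowersMod4} {sumsMod4 k}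
    (here refl) (0∈sumsMod4 k)

sumPow-mod4 : ∀ {k} xs n → length xs ≤ k → ∃[ s ] s ∈ sumsMod4 k × sumPow 6 xs n ≡ s [modπ^ 6 ]
sumPow-mod4 {k}     []       n _              = 0T , 0∈sumsMod4 k , modπ-refl
sumPow-mod4 {suc k} (x ∷ xs) n (s≤s |xs|≤k) =
  let s₁ , s₁∈ , x⁶≡s₁ = sixth-power-mod4 (x n)
      s₂ , s₂∈ , Σ≡s₂  = sumPow-mod4 xs n |xs|≤k
  in reduce-mod2^ 2 (s₁ +T s₂) ,
     ∈-cartesianProductWith⁺ (λ s u → reduce-mod2^ 2 (s +T u)) {sixthPowersMod4} {sumsMod4 k} s₁∈ s₂∈ ,
     modπ-trans (+-cong-modπ {(x ^R 6) n} {s₁} {sumPow 6 xs n} {s₂}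
                             (modπ-trans (≡⇒modπ (^R-pointwise x 6 n)) x⁶≡s₁) Σ≡s₂)
                (≡-reduce-mod2^ 2 (s₁ +T s₂))

-- An element needing six sixth powers

Y₀ : Tri
Y₀ = tri (+ 138) (+ 108) (+ 81)

y₀ : R
y₀ = const Y₀

y₀-in-semigroup : InPowSemigroup 6 y₀
y₀-in-semigroup =
  map const summands , const-allValid summands , s≤s z≤n ,
  λ n → modπ³ⁿ⇒mod2^ {n = n} (≡⇒modπ (sumPow-const summands n))
  where
  summands = 1T ∷ 1T ∷ 1T ∷ 1+π ∷ 1+π ∷ 1+π ∷ []

mod2^? : ∀ n x y → Dec (x ≈Tri y [mod2^ n ])
mod2^? n x y = (2 ℕ.^ n ℕ.∣? ∣ c₀ x - c₀ y ∣) ×-dec (2 ℕ.^ n ℕ.∣? ∣ c₁ x - c₁ y ∣)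
                 ×-dec (2 ℕ.^ n ℕ.∣? ∣ c₂ x - c₂ y ∣)

y₀-not-in-sumsMod4 : All (λ s → ¬ (Y₀ ≈Tri s [mod2^ 2 ])) (sumsMod4 5)
y₀-not-in-sumsMod4 = from-yes (all? (λ s → ¬? (mod2^? 2 Y₀ s)) (sumsMod4 5))

y₀-needs-six : ∀ {m} → m < 6 → ¬ SumOfAtMost 6 m y₀
y₀-needs-six m<6 (xs , _ , |xs|≤m , Σ≈y₀) =
  let s , s∈ , Σ≡s = sumPow-mod4 xs 2 (ℕ.≤-trans |xs|≤m (ℕ.≤-pred m<6))
  in All.lookup y₀-not-in-sumsMod4 s∈
       (modπ³ⁿ⇒mod2^ {n = 2} (modπ-trans (modπ-sym (mod2^⇒modπ³ⁿ {n = 2} (Σ≈y₀ 2))) Σ≡s))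

theorem3p7 : WaringNumberIs 6 6
theorem3p7 =
  s≤s z≤n ,
  sixth-power-sums-need-at-most-six ,
  λ _ _ m<6 bounded → y₀-needs-six m<6 (bounded y₀ (const-valid Y₀) y₀-in-semigroup)
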